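{- Let $G$ be a finite simple graph with vertices $v_1,\ldots,v_n$, $L$ a list of $G$ and $w$ a weight of $G$. Then a vector $\vec w^*\in\mathbb N^n$ is a solution to the on call problem for $(G,L,w)$ if and only if $\vec w^*\in\min(\vec w,\overrightarrow{W}_{max}(G,L))$ and $\|\vec w^*\|\ge\|\vec w'\|$ for every $\vec w'\in\min(\vec w,\overrightarrow{W}_{max}(G,L))$.
   Context: A list of $G$ assigns to each vertex $v$ a finite set $L(v)\subset\mathbb N$; $\overline L=\bigcup_v L(v)$. A weight is a map $w:V(G)\to\mathbb N$ with weight-vector $\vec w=\sum_i w(v_i)\vec e_i$. An $(L,w)$-coloring is a map $C$ with $C(v)\subset L(v)$, $|C(v)|=w(v)$ and $C(v)\cap C(v')=\emptyset$ for every edge $vv'$. $\overrightarrow{W}(G,L)$ is the set of $\vec w\in\mathbb N^n$ such that $G$ is $(L,w)$-colorable. For $\vec x\in\mathbb N^n$, $\|\vec x\|=\sum_i x_i$; $\vec y\le\vec x$ means coordinatewise inequality; $\min(\vec x,\vec y)$ is the coordinatewise minimum. A solution to the on call problem for $(G,L,w)$ is a vector $\vec w^*\in\overrightarrow{W}(G,L)$ with $\vec w^*\le\vec w$ such that $\|\vec w-\vec w^*\|$ is minimal among all such vectors. For $N\subset V(G)$, $\vec N=\sum_i\lambda_i\vec e_i$ with $\lambda_i=1$ if $v_i\in N$, else $0$. For a color $x$, $G^x$ is the subgraph induced by the vertices $v$ with $x\in L(v)$; $\overrightarrow{MIS}(H)=\{\vec N: N$ a maximal (w.r.t. inclusion)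 independent set of $H\}$; $\overrightarrow{W}_{max}(G,L)=\sum_{x\in\overline L}\overrightarrow{MIS}(G^x)$ (vectorial sum of sets). Finally $\min(\vec w,\overrightarrow{W}_{max}(G,L))=\{\min(\vec w,\vec w'):\vec w'\in\overrightarrow{W}_{max}(G,L)\}$. -}

module Defs where

open import Data.Nat using (ℕ; zero; suc; _+_; _∸_; _⊓_; _≤_; _≟_)
open import Data.Fin using (Fin; zero; suc)
open import Data.Bool using (Bool; true; false)
open import Data.List using (List; []; _∷_; length; concat; map; deduplicate)
open import Data.List.Membership.Propositional using (_∈_)
open import Data.List.Relation.Unary.Unique.Propositional using (Unique)
open import Data.Product using (Σ; _×_; ∃)
open import Data.Empty using (⊥)
open import Relation.Binary.PropositionalEquality using (_≡_)
open import Data.List using (allFin)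

record SimpleGraph (n : ℕ) : Set where
  field
    Adj    : Fin n → Fin n → Bool
    sym    : ∀ u v → Adj u v ≡ Adj v u
    irrefl : ∀ v → Adj v v ≡ false
open SimpleGraph public

-- A list of G: each vertex gets a finite set of colours (a finite list;
-- the set is its membership relation).
ListAssignment : ℕ → Set
ListAssignment n = Fin n → List ℕ

NVec : ℕ → Set
NVec n = Fin n → ℕ

‖_‖ : ∀ {n} → NVec n → ℕ
‖_‖ {zero}  x = 0
‖_‖ {suc n} x = x zero + ‖ (λ i → x (suc i)) ‖

_≤ᵥ_ : ∀ {n} → NVec n → NVec n → Set
x ≤ᵥ y = ∀ i → x i ≤ y i

_-ᵥ_ : ∀ {n} → NVec n → NVec n → NVec n
(x -ᵥ y) i = x i ∸ y i

minᵥ : ∀ {n} → NVec n → NVec n → NVec n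
minᵥ x y i = x i ⊓ y i

_≗ᵥ_ : ∀ {n} → NVec n → NVec n → Set
x ≗ᵥ y = ∀ i → x i ≡ y i

IsColoring : ∀ {n} → SimpleGraph n → ListAssignment n → NVec n → (Fin n → List ℕ) → Set
IsColoring G L w C =
    (∀ v → Unique (C v))
  × (∀ v → length (C v) ≡ w v)
  × (∀ v x → x ∈ C v → x ∈ L v)
  × (∀ u v → Adj G u v ≡ true → ∀ x → x ∈ C u → x ∈ C v → ⊥)

InW : ∀ {n} → SimpleGraph n → ListAssignment n → NVec n → Set
InW G L w = ∃ λ C → IsColoring G L w C

IsOnCallSolution : ∀ {n} → SimpleGraph n → ListAssignment n → NVec n → NVec n → Set
IsOnCallSolution G L w w* =
    InW G L w*
  × w* ≤ᵥ w
  × (∀ w' → InW G L w' → w' ≤ᵥ w → ‖ w -ᵥ w* ‖ ≤ ‖ w -ᵥ w' ‖)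

Subset : ℕ → Set
Subset n = Fin n → Bool

indicator : Bool → ℕ
indicator true  = 1
indicator false = 0

vecOf : ∀ {n} → Subset n → NVec n
vecOf N i = indicator (N i)

-- N is an independent set of G^x (the subgraph induced by {v : x ∈ L(v)})
IsIndepIn : ∀ {n} → SimpleGraph n → ListAssignment n → ℕ → Subset n → Set
IsIndepIn G L x N =
    (∀ v → N v ≡ true → x ∈ L v)
  × (∀ u v → N u ≡ true → N v ≡ true → Adj G u v ≡ false)

_⊆ₛ_ : ∀ {n} → Subset n → Subset n → Set
N ⊆ₛ M = ∀ v → N v ≡ true → M v ≡ true

IsMISIn : ∀ {n} → SimpleGraph n → ListAssignment n → ℕ → Subset n → Set
IsMISIn G L x N =
    IsIndepIn G L x N
  × (∀ M → IsIndepIn G L x M → N ⊆ₛ M → M ⊆ₛ N)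

Lbar : ∀ {n} → ListAssignment n → List ℕ
Lbar {n} L = deduplicate _≟_ (concat (map L (allFin n)))

sumSets : ∀ {n} → List ℕ → (ℕ → Subset n) → NVec n
sumSets []       f i = 0
sumSets (x ∷ xs) f i = indicator (f x i) + sumSets xs f i

InWmax : ∀ {n} → SimpleGraph n → ListAssignment n → NVec n → Set
InWmax G L w =
  ∃ λ (f : ℕ → Subset _) →
      (∀ x → x ∈ Lbar L → IsMISIn G L x (f x))
    × (w ≗ᵥ sumSets (Lbar L) f)

InMinWmax : ∀ {n} → SimpleGraph n → ListAssignment n → NVec n → NVec n → Set
InMinWmax G L w u = ∃ λ w' → InWmax G L w' × (u ≗ᵥ minᵥ w w')

-- Every colour class of an (L,w)-colouring is an independent set of G^x and so extends to a
-- maximal one; hence every vector of W(G,L) is dominated by a vector of W_max(G,L).  Conversely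
-- W_max(G,L) ⊆ W(G,L) (give v the colours x whose chosen maximal independent set contains v),
-- and W(G,L) is closed downwards.  So min(w, W_max) lies in W ∩ ↓w and dominates it, and such
-- a subset has the same elements of maximum norm.  Finally, for vectors below w, minimising
-- ‖w − w*‖ is the same as maximising ‖w*‖.
module Submission where

open import Defs
open import Data.Nat using (ℕ; _≤_)
open import Data.Product using (_×_)
open import Function.Bundles using (_⇔_)

open import Data.Bool using (true; false)
import Data.Bool.Properties as Bool
open import Data.Empty using (⊥-elim)
open import Data.Fin using (Fin; zero; suc)
import Data.Fin.Properties as Fin
open import Data.List using (List; []; _∷_; length; filter; take; foldl; concat; map; allFin)
open import Data.List.Properties using (length-take)
open import Data.List.Membership.Propositional using (_∈_; _∉_)
open import Data.List.Membership.Propositional.Properties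
  using (∈-filter⁺; ∈-filter⁻; ∈-deduplicate⁺; ∈-concat⁺′; ∈-map⁺; ∈-allFin)
open import Data.List.Membership.DecPropositional Data.Nat._≟_ using (_∈?_)
open import Data.List.Relation.Binary.Sublist.Propositional as Sublist using ()
open import Data.List.Relation.Binary.Sublist.Propositional.Properties using (take-⊆)
open import Data.List.Relation.Unary.All as All using ()
open import Data.List.Relation.Unary.AllPairs using ([]; _∷_)
open import Data.List.Relation.Unary.Any using (here; there; _─_)
open import Data.List.Relation.Unary.Unique.Propositional using (Unique)
open import Data.List.Relation.Unary.Unique.Propositional.Properties using (filter⁺; take⁺)
open import Data.List.Relation.Unary.Unique.DecPropositional.Properties Data.Nat._≟_
  using (deduplicate-!)
open import Data.Nat using (zero; suc; _+_; _⊓_; z≤n; s≤s)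
open import Data.Nat.Properties
open import Algebra.Properties.CommutativeSemigroup +-commutativeSemigroup using (interchange)
open import Data.Product using (∃; _,_; proj₁; proj₂)
open import Data.Sum using (_⊎_; inj₁; inj₂)
open import Function using (_∘_)
open import Function.Bundles using (mk⇔; Equivalence)
open import Function.Properties.Equivalence using () renaming (trans to ⇔-trans)
open import Relation.Unary using (Decidable)
open import Relation.Nullary.Decidable using (dec-true)
open import Relation.Nullary using (Dec; yes; no; ¬_; ¬?; _⊎-dec_; _×-dec_; does)
open import Relation.Binary.PropositionalEquality
  using (_≡_; _≢_; refl; trans; cong; cong₂; module ≡-Reasoning)
  renaming (sym to ≡-sym)

private
  variable
    n : ℕ

‖‖-cong : {x y : NVec n} → x ≗ᵥ y → ‖ x ‖ ≡ ‖ y ‖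
‖‖-cong {zero}  e = refl
‖‖-cong {suc n} e = cong₂ _+_ (e zero) (‖‖-cong (e ∘ suc))

‖‖-mono-≤ : {x y : NVec n} → x ≤ᵥ y → ‖ x ‖ ≤ ‖ y ‖
‖‖-mono-≤ {zero}  le = z≤n
‖‖-mono-≤ {suc n} le = +-mono-≤ (le zero) (‖‖-mono-≤ (le ∘ suc))

‖‖-+ : (x y : NVec n) → ‖ (λ i → x i + y i) ‖ ≡ ‖ x ‖ + ‖ y ‖
‖‖-+ {zero}  x y = refl
‖‖-+ {suc n} x y = begin
  (x zero + y zero) + ‖ (λ i → x (suc i) + y (suc i)) ‖
    ≡⟨ cong ((x zero + y zero) +_) (‖‖-+ (x ∘ suc) (y ∘ suc)) ⟩
  (x zero + y zero) + (‖ x ∘ suc ‖ + ‖ y ∘ suc ‖)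
    ≡⟨ interchange (x zero) (y zero) ‖ x ∘ suc ‖ ‖ y ∘ suc ‖ ⟩
  (x zero + ‖ x ∘ suc ‖) + (y zero + ‖ y ∘ suc ‖) ∎
  where open ≡-Reasoning

‖-ᵥ‖+‖‖ : {x y : NVec n} → y ≤ᵥ x → ‖ x -ᵥ y ‖ + ‖ y ‖ ≡ ‖ x ‖
‖-ᵥ‖+‖‖ {x = x} {y} y≤x =
  trans (≡-sym (‖‖-+ (x -ᵥ y) y)) (‖‖-cong (λ i → m∸n+n≡m (y≤x i)))

‖‖≡0⇒≗0 : {x : NVec n} → ‖ x ‖ ≡ 0 → ∀ i → x i ≡ 0
‖‖≡0⇒≗0 {suc n} h zero    = m+n≡0⇒m≡0 _ h
‖‖≡0⇒≗0 {suc n} h (suc i) = ‖‖≡0⇒≗0 (m+n≡0⇒n≡0 _ h) i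

≤ᵥ∧‖‖-≥⇒≗ᵥ : {x y : NVec n} → x ≤ᵥ y → ‖ y ‖ ≤ ‖ x ‖ → x ≗ᵥ y
≤ᵥ∧‖‖-≥⇒≗ᵥ {x = x} {y} x≤y ‖y‖≤‖x‖ i =
  ≤-antisym (x≤y i) (m∸n≡0⇒m≤n (‖‖≡0⇒≗0 ‖y-x‖≡0 i))
  where
  ‖y-x‖≡0 : ‖ y -ᵥ x ‖ ≡ 0
  ‖y-x‖≡0 = n≤0⇒n≡0 (+-cancelʳ-≤ ‖ x ‖ ‖ y -ᵥ x ‖ 0
              (≤-trans (≤-reflexive (‖-ᵥ‖+‖‖ x≤y)) ‖y‖≤‖x‖))

m+n≡o+p⇒[m≤o⇔p≤n] : ∀ {m n o p} → m + n ≡ o + p → (m ≤ o ⇔ p ≤ n)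
m+n≡o+p⇒[m≤o⇔p≤n] {m} {n} {o} {p} e = mk⇔
  (λ m≤o → +-cancelˡ-≤ o p n (≤-trans (≤-reflexive (≡-sym e)) (+-monoˡ-≤ n m≤o)))
  (λ p≤n → +-cancelʳ-≤ n m o (≤-trans (≤-reflexive e) (+-monoʳ-≤ o p≤n)))

‖-ᵥ‖-≤⇔‖‖-≥ : {w u v : NVec n} → u ≤ᵥ w → v ≤ᵥ w →
              (‖ w -ᵥ u ‖ ≤ ‖ w -ᵥ v ‖ ⇔ ‖ v ‖ ≤ ‖ u ‖)
‖-ᵥ‖-≤⇔‖‖-≥ u≤w v≤w =
  m+n≡o+p⇒[m≤o⇔p≤n] (trans (‖-ᵥ‖+‖‖ u≤w) (≡-sym (‖-ᵥ‖+‖‖ v≤w)))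

MaxNormIn : (NVec n → Set) → NVec n → Set
MaxNormIn A u = A u × (∀ v → A v → ‖ v ‖ ≤ ‖ u ‖)

maxNormIn-dominating : (A B : NVec n → Set) →
  (∀ u → B u → A u) → (∀ u → A u → ∃ λ v → B v × u ≤ᵥ v) →
  (∀ u v → u ≗ᵥ v → B u → B v) →
  ∀ u → MaxNormIn A u ⇔ MaxNormIn B u
maxNormIn-dominating A B B⊆A dom B-resp u = mk⇔ to from
  where
  to : MaxNormIn A u → MaxNormIn B u
  to (Au , max) =
    let (v , Bv , u≤v) = dom u Au in
    B-resp v u (λ i → ≡-sym (≤ᵥ∧‖‖-≥⇒≗ᵥ u≤v (max v (B⊆A v Bv)) i)) Bv ,
    (λ v′ Bv′ → max v′ (B⊆A v′ Bv′))
  from : MaxNormIn B u → MaxNormIn A u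
  from (Bu , max) =
    B⊆A u Bu ,
    (λ v Av → let (v′ , Bv′ , v≤v′) = dom v Av in ≤-trans (‖‖-mono-≤ v≤v′) (max v′ Bv′))

∈-─ : ∀ {A : Set} {x y : A} {ys : List A} (p : x ∈ ys) → y ∈ ys → y ≢ x → y ∈ (ys ─ p)
∈-─ (here refl) (here refl) y≢x = ⊥-elim (y≢x refl)
∈-─ (here _)    (there q)   _   = q
∈-─ (there p)   (here refl) _   = here refl
∈-─ (there p)   (there q)   y≢x = there (∈-─ p q y≢x)

length-─ : ∀ {A : Set} {x : A} {ys : List A} (p : x ∈ ys) → length ys ≡ suc (length (ys ─ p))
length-─ (here _)  = refl
length-─ (there p) = cong suc (length-─ p)

Unique∧⊆⇒length-≤ : ∀ {A : Set} {xs ys : List A} →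
  Unique xs → (∀ {z} → z ∈ xs → z ∈ ys) → length xs ≤ length ys
Unique∧⊆⇒length-≤ []                 _   = z≤n
Unique∧⊆⇒length-≤ (x∉xs ∷ xs-unique) sub =
  ≤-trans (s≤s (Unique∧⊆⇒length-≤ xs-unique
                  (λ z∈xs → ∈-─ x∈ys (sub (there z∈xs)) (All.lookup x∉xs z∈xs ∘ ≡-sym))))
          (≤-reflexive (≡-sym (length-─ x∈ys)))
  where
  x∈ys : _ ∈ _
  x∈ys = sub (here refl)

contains? : (f : ℕ → Subset n) (v : Fin n) → Decidable (λ x → f x v ≡ true)
contains? f v x = f x v Bool.≟ true

coloursAt : (ℕ → Subset n) → Fin n → List ℕ → List ℕ
coloursAt f v = filter (contains? f v)

length-coloursAt : (f : ℕ → Subset n) (v : Fin n) (xs : List ℕ) →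
                   length (coloursAt f v xs) ≡ sumSets xs f v
length-coloursAt f v []       = refl
length-coloursAt f v (x ∷ xs) with f x v
... | true  = cong suc (length-coloursAt f v xs)
... | false = length-coloursAt f v xs

∈-Lbar : (L : ListAssignment n) (v : Fin n) {x : ℕ} → x ∈ L v → x ∈ Lbar L
∈-Lbar {n} L v x∈Lv = ∈-deduplicate⁺ Data.Nat._≟_ (∈-concat⁺′ x∈Lv (∈-map⁺ L (∈-allFin v)))

¬true≡false : ¬ (true ≡ false)
¬true≡false ()

module _ (G : SimpleGraph n) (L : ListAssignment n) where

  InW-↓ : ∀ {u v} → v ≤ᵥ u → InW G L u → InW G L v
  InW-↓ {v = v} v≤u (C , unique , len , ⊆L , proper) =
    take-v , (λ i → take⁺ (v i) (unique i)) , len′ ,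
    (λ i x x∈ → ⊆L i x (∈-take (v i) x∈)) ,
    (λ a b adj x x∈a x∈b → proper a b adj x (∈-take (v a) x∈a) (∈-take (v b) x∈b))
    where
    ∈-take : ∀ {z} k {xs : List ℕ} → z ∈ take k xs → z ∈ xs
    ∈-take k {xs} = Sublist.lookup (take-⊆ k xs)
    take-v : Fin n → List ℕ
    take-v i = take (v i) (C i)
    len′ : ∀ i → length (take-v i) ≡ v i
    len′ i = trans (length-take (v i) (C i)) (trans (cong (v i ⊓_) (len i)) (m≤n⇒m⊓n≡m (v≤u i)))

  Wmax⊆W : ∀ {u} → InWmax G L u → InW G L u
  Wmax⊆W (f , mis , u≗) =
    C , (λ v → filter⁺ (contains? f v) (deduplicate-! (concat (map L (allFin n))))) ,
    (λ v → trans (length-coloursAt f v (Lbar L)) (≡-sym (u≗ v))) ,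
    (λ v x x∈ →
      let (x∈L̄ , fxv) = ∈-filter⁻ (contains? f v) {xs = Lbar L} x∈ in
      proj₁ (proj₁ (mis x x∈L̄)) v fxv) ,
    (λ a b adj x x∈a x∈b →
      let (x∈L̄ , fxa) = ∈-filter⁻ (contains? f a) {xs = Lbar L} x∈a
          (_ , fxb)   = ∈-filter⁻ (contains? f b) {xs = Lbar L} x∈b in
      ¬true≡false (trans (≡-sym adj) (proj₂ (proj₁ (mis x x∈L̄)) a b fxa fxb)))
    where
    C : Fin n → List ℕ
    C v = coloursAt f v (Lbar L)

  module Saturation (x : ℕ) where

    Indep : Subset n → Set
    Indep = IsIndepIn G L x

    -- v cannot be added to S any more.
    Settled : Subset n → Fin n → Set
    Settled S v = S v ≡ true ⊎ x ∉ L v ⊎ ∃ λ u → S u ≡ true × Adj G u v ≡ true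

    settled? : ∀ S v → Dec (Settled S v)
    settled? S v =
      (S v Bool.≟ true) ⊎-dec ¬? (x ∈? L v)
                        ⊎-dec Fin.any? (λ u → (S u Bool.≟ true) ×-dec (Adj G u v Bool.≟ true))

    Settled-mono : ∀ {S S′} v → S ⊆ₛ S′ → Settled S v → Settled S′ v
    Settled-mono v S⊆S′ (inj₁ Sv)                 = inj₁ (S⊆S′ v Sv)
    Settled-mono v S⊆S′ (inj₂ (inj₁ x∉Lv))        = inj₂ (inj₁ x∉Lv)
    Settled-mono v S⊆S′ (inj₂ (inj₂ (u , Su , a))) = inj₂ (inj₂ (u , S⊆S′ u Su , a))

    allSettled⇒maximal : ∀ {M} → Indep M → (∀ v → Settled M v) → IsMISIn G L x M
    allSettled⇒maximal {M} indep settled = indep , maximal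
      where
      maximal : ∀ M′ → Indep M′ → M ⊆ₛ M′ → M′ ⊆ₛ M
      maximal M′ (⊆G^x , noEdge) M⊆M′ v M′v with settled v
      ... | inj₁ Mv                  = Mv
      ... | inj₂ (inj₁ x∉Lv)         = ⊥-elim (x∉Lv (⊆G^x v M′v))
      ... | inj₂ (inj₂ (u , Mu , a)) =
        ⊥-elim (¬true≡false (trans (≡-sym a) (noEdge u v (M⊆M′ u Mu) M′v)))

    insert : Fin n → Subset n → Subset n
    insert v S u with u Fin.≟ v
    ... | yes _ = true
    ... | no  _ = S u

    insert-inv : ∀ v S u → insert v S u ≡ true → u ≡ v ⊎ S u ≡ true
    insert-inv v S u Su with u Fin.≟ v
    ... | yes u≡v = inj₁ u≡v
    ... | no  _   = inj₂ Su

    insert-⊇ : ∀ v S → S ⊆ₛ insert v S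
    insert-⊇ v S u Su with u Fin.≟ v
    ... | yes _ = refl
    ... | no  _ = Su

    insert-∋ : ∀ v S → insert v S v ≡ true
    insert-∋ v S with v Fin.≟ v
    ... | yes _   = refl
    ... | no  v≢v = ⊥-elim (v≢v refl)

    insert-indep : ∀ {S v} → Indep S → ¬ Settled S v → Indep (insert v S)
    insert-indep {S} {v} (⊆G^x , noEdge) unsettled = ⊆G^x′ , noEdge′
      where
      x∈Lv : x ∈ L v
      x∈Lv with x ∈? L v
      ... | yes x∈ = x∈
      ... | no  x∉ = ⊥-elim (unsettled (inj₂ (inj₁ x∉)))
      ¬adj : ∀ u → S u ≡ true → Adj G u v ≡ false
      ¬adj u Su with Adj G u v in a
      ... | true  = ⊥-elim (unsettled (inj₂ (inj₂ (u , Su , a))))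
      ... | false = refl
      ⊆G^x′ : ∀ u → insert v S u ≡ true → x ∈ L u
      ⊆G^x′ u Su′ with insert-inv v S u Su′
      ... | inj₁ refl = x∈Lv
      ... | inj₂ Su   = ⊆G^x u Su
      noEdge′ : ∀ a b → insert v S a ≡ true → insert v S b ≡ true → Adj G a b ≡ false
      noEdge′ a b Sa′ Sb′ with insert-inv v S a Sa′ | insert-inv v S b Sb′
      ... | inj₁ refl | inj₁ refl = irrefl G a
      ... | inj₁ refl | inj₂ Sb   = trans (sym G a b) (¬adj b Sb)
      ... | inj₂ Sa   | inj₁ refl = ¬adj a Sa
      ... | inj₂ Sa   | inj₂ Sb   = noEdge a b Sa Sb

    settle : Subset n → Fin n → Subset n
    settle S v with settled? S v
    ... | yes _ = S
    ... | no  _ = insert v S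

    settle-indep : ∀ {S} v → Indep S → Indep (settle S v)
    settle-indep {S} v indep with settled? S v
    ... | yes _         = indep
    ... | no  unsettled = insert-indep indep unsettled

    settle-⊇ : ∀ S v → S ⊆ₛ settle S v
    settle-⊇ S v with settled? S v
    ... | yes _ = λ _ Su → Su
    ... | no  _ = insert-⊇ v S

    settle-settles : ∀ S v → Settled (settle S v) v
    settle-settles S v with settled? S v
    ... | yes settled = settled
    ... | no  _       = inj₁ (insert-∋ v S)

    saturate : Subset n → List (Fin n) → Subset n
    saturate = foldl settle

    saturate-indep : ∀ {S} vs → Indep S → Indep (saturate S vs)
    saturate-indep []       indep = indep
    saturate-indep (v ∷ vs) indep = saturate-indep vs (settle-indep v indep)

    saturate-⊇ : ∀ S vs → S ⊆ₛ saturate S vs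
    saturate-⊇ S []       = λ _ Su → Su
    saturate-⊇ S (v ∷ vs) = λ u Su → saturate-⊇ (settle S v) vs u (settle-⊇ S v u Su)

    saturate-settles : ∀ S vs {v} → v ∈ vs → Settled (saturate S vs) v
    saturate-settles S (v ∷ vs) (here refl) =
      Settled-mono v (saturate-⊇ (settle S v) vs) (settle-settles S v)
    saturate-settles S (_ ∷ vs) (there v∈vs) = saturate-settles _ vs v∈vs

    extend-to-MIS : ∀ {N} → Indep N → ∃ λ M → IsMISIn G L x M × N ⊆ₛ M
    extend-to-MIS {N} indep =
      saturate N (allFin n) ,
      allSettled⇒maximal (saturate-indep (allFin n) indep)
                         (λ v → saturate-settles N (allFin n) (∈-allFin v)) ,
      saturate-⊇ N (allFin n)

  W⊆↓Wmax : ∀ {u} → InW G L u → ∃ λ w′ → InWmax G L w′ × u ≤ᵥ w′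
  W⊆↓Wmax {u} (C , unique , len , ⊆L , proper) =
    sumSets (Lbar L) f , (f , (λ x _ → proj₁ (proj₂ (mis x))) , (λ _ → refl)) , u≤
    where
    colourClass : ℕ → Subset n
    colourClass x v = does (x ∈? C v)
    member : ∀ x v → colourClass x v ≡ true → x ∈ C v
    member x v _  with x ∈? C v
    member x v _  | yes x∈ = x∈
    member x v () | no  _
    classIndep : ∀ x → IsIndepIn G L x (colourClass x)
    classIndep x =
      (λ v cv → ⊆L v x (member x v cv)) ,
      (λ a b ca cb → Bool.¬-not (λ adj → proper a b adj x (member x a ca) (member x b cb)))
    mis : ∀ x → ∃ λ M → IsMISIn G L x M × colourClass x ⊆ₛ M
    mis x = Saturation.extend-to-MIS x (classIndep x)
    f : ℕ → Subset n
    f x = proj₁ (mis x)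
    covered : ∀ v {x} → x ∈ C v → f x v ≡ true
    covered v {x} x∈ = proj₂ (proj₂ (mis x)) v (dec-true (x ∈? C v) x∈)
    u≤ : u ≤ᵥ sumSets (Lbar L) f
    u≤ v = begin
      u v                             ≡⟨ ≡-sym (len v) ⟩
      length (C v)                    ≤⟨ Unique∧⊆⇒length-≤ (unique v) C⊆coloursAt ⟩
      length (coloursAt f v (Lbar L)) ≡⟨ length-coloursAt f v (Lbar L) ⟩
      sumSets (Lbar L) f v            ∎
      where
      open ≤-Reasoning
      C⊆coloursAt : ∀ {x} → x ∈ C v → x ∈ coloursAt f v (Lbar L)
      C⊆coloursAt x∈ = ∈-filter⁺ (contains? f v) (∈-Lbar L v (⊆L v _ x∈)) (covered v x∈)

  InMinWmax-resp-≗ᵥ : ∀ {w u v} → u ≗ᵥ v → InMinWmax G L w u → InMinWmax G L w v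
  InMinWmax-resp-≗ᵥ u≗v (w′ , w′∈Wmax , u≗) = w′ , w′∈Wmax , λ i → trans (≡-sym (u≗v i)) (u≗ i)

  minWmax⊆W↓ : ∀ {w u} → InMinWmax G L w u → InW G L u × u ≤ᵥ w
  minWmax⊆W↓ {w} {u} (w′ , w′∈Wmax , u≗) =
    InW-↓ (λ i → ≤-trans (≤-reflexive (u≗ i)) (m⊓n≤n (w i) (w′ i))) (Wmax⊆W w′∈Wmax) ,
    (λ i → ≤-trans (≤-reflexive (u≗ i)) (m⊓n≤m (w i) (w′ i)))

  W↓⊆↓minWmax : ∀ {w u} → InW G L u → u ≤ᵥ w → ∃ λ v → InMinWmax G L w v × u ≤ᵥ v
  W↓⊆↓minWmax {w} u∈W u≤w =
    let (w′ , w′∈Wmax , u≤w′) = W⊆↓Wmax u∈W in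
    minᵥ w w′ , (w′ , w′∈Wmax , λ _ → refl) , (λ i → ⊓-glb (u≤w i) (u≤w′ i))

  onCallSolution⇔maxNorm : ∀ w w* →
    IsOnCallSolution G L w w* ⇔ MaxNormIn (λ u → InW G L u × u ≤ᵥ w) w*
  onCallSolution⇔maxNorm w w* = mk⇔
    (λ (w*∈W , w*≤w , opt) → (w*∈W , w*≤w) ,
       λ v (v∈W , v≤w) → Equivalence.to (‖-ᵥ‖-≤⇔‖‖-≥ w*≤w v≤w) (opt v v∈W v≤w))
    (λ ((w*∈W , w*≤w) , max) → w*∈W , w*≤w ,
       λ v v∈W v≤w → Equivalence.from (‖-ᵥ‖-≤⇔‖‖-≥ w*≤w v≤w) (max v (v∈W , v≤w)))

theorem6p1 : (n : ℕ) (G : SimpleGraph n) (L : ListAssignment n) (w w* : NVec n) →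
    IsOnCallSolution G L w w* ⇔
      (InMinWmax G L w w* × (∀ w' → InMinWmax G L w w' → ‖ w' ‖ ≤ ‖ w* ‖))
theorem6p1 n G L w w* =
  ⇔-trans (onCallSolution⇔maxNorm G L w w*)
    (maxNormIn-dominating (λ u → InW G L u × u ≤ᵥ w) (InMinWmax G L w)
      (λ u → minWmax⊆W↓ G L)
      (λ u (u∈W , u≤w) → W↓⊆↓minWmax G L u∈W u≤w)
      (λ u v → InMinWmax-resp-≗ᵥ G L)
      w*)
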